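{- As formal power series in $x$, $$c_1^5e^{\alpha x}+c_2^5e^{\beta x}+c_3^5e^{\gamma x}=\frac{1}{968}\sum_{n=0}^\infty T_n^{(5,6,15)}\frac{x^n}{n!}.$$
   Context: Let $\alpha,\beta,\gamma$ be the three distinct complex roots of $x^3-x^2-x-1=0$, and set $c_1=\frac{\alpha}{(\alpha-\beta)(\alpha-\gamma)}$, $c_2=\frac{\beta}{(\beta-\alpha)(\beta-\gamma)}$, $c_3=\frac{\gamma}{(\gamma-\alpha)(\gamma-\beta)}$. For numbers $s_0,s_1,s_2$, the sequence $T_n^{(s_0,s_1,s_2)}$ is defined by $T_0^{(s_0,s_1,s_2)}=s_0$, $T_1^{(s_0,s_1,s_2)}=s_1$, $T_2^{(s_0,s_1,s_2)}=s_2$ and $T_n^{(s_0,s_1,s_2)}=T_{n-1}^{(s_0,s_1,s_2)}+T_{n-2}^{(s_0,s_1,s_2)}+T_{n-3}^{(s_0,s_1,s_2)}$ for $n\ge3$. -}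

module Defs where

open import Level using (Level; _⊔_) renaming (suc to lsuc)
open import Data.Nat as ℕ using (ℕ; zero; suc)
open import Algebra.Bundles using (CommutativeRing)
open import Relation.Nullary using (¬_)

-- A field: a commutative ring with 0 ≉ 1 and a (total) inverse
-- operation _⁻¹ that is a genuine multiplicative inverse on nonzero
-- elements (the value 0⁻¹ is irrelevant and unconstrained).
record Field (c ℓ : Level) : Set (lsuc (c ⊔ ℓ)) where
  field
    commutativeRing : CommutativeRing c ℓ
  open CommutativeRing commutativeRing public
  field
    _⁻¹        : Carrier → Carrier
    ⁻¹-inverse : ∀ x → ¬ (x ≈ 0#) → x * (x ⁻¹) ≈ 1#
    0≉1        : ¬ (0# ≈ 1#)

module FieldDefs {c ℓ : Level} (F : Field c ℓ) where
  open Field F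

  infixr 8 _^_
  infixl 7 _/_
  infixl 6 _+ₛ_
  infixr 7 _·ₛ_
  infix 4 _≈ₛ_

  _/_ : Carrier → Carrier → Carrier
  x / y = x * (y ⁻¹)

  _^_ : Carrier → ℕ → Carrier
  x ^ zero  = 1#
  x ^ suc n = x * (x ^ n)

  fromℕ : ℕ → Carrier
  fromℕ zero    = 0#
  fromℕ (suc n) = 1# + fromℕ n

  CharZero : Set ℓ
  CharZero = ∀ n → ¬ (fromℕ (suc n) ≈ 0#)

  fact : ℕ → Carrier
  fact n = fromℕ (n ℕ.!)

  T : Carrier → Carrier → Carrier → ℕ → Carrier
  T s₀ s₁ s₂ zero                = s₀
  T s₀ s₁ s₂ (suc zero)          = s₁
  T s₀ s₁ s₂ (suc (suc zero))    = s₂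
  T s₀ s₁ s₂ (suc (suc (suc n))) =
    T s₀ s₁ s₂ (suc (suc n)) + T s₀ s₁ s₂ (suc n) + T s₀ s₁ s₂ n

  -- formal power series in x: the sequence of coefficients of x^n
  FPS : Set c
  FPS = ℕ → Carrier

  _≈ₛ_ : FPS → FPS → Set ℓ
  f ≈ₛ g = ∀ n → f n ≈ g n

  _+ₛ_ : FPS → FPS → FPS
  (f +ₛ g) n = f n + g n

  _·ₛ_ : Carrier → FPS → FPS
  (a ·ₛ f) n = a * f n

  expS : Carrier → FPS
  expS a n = (a ^ n) / fact n

  egf : (ℕ → Carrier) → FPS
  egf u n = u n / fact n

  cubic : Carrier → Carrier
  cubic x = x ^ 3 - x ^ 2 - x - 1#

{-# OPTIONS --safe #-}
-- For the cubic p(x) = x³ − x² − x − 1 one has (α − β)(α − γ) = p′(α), so each coefficient is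
-- c = r/p′(r) for a root r, and computing in ℤ[x]/(p) gives 21296·c⁵ = 25 + 38r − r². Hence the
-- coefficient Sₙ = Σ c⁵rⁿ of xⁿ/n! on the left satisfies 21296·Sₙ = 25·sₙ + 38·sₙ₊₁ − sₙ₊₂,
-- where sₙ = αⁿ + βⁿ + γⁿ. The power sums obey the tribonacci recurrence and start 3, 1, 3
-- (Vieta), so s = T(3,1,3); the combination 25·sₙ + 38·sₙ₊₁ − sₙ₊₂ is again tribonacci and
-- starts 110, 132, 330 = 22·(5, 6, 15). As 21296 = 22·968, Sₙ = T(5,6,15)ₙ / 968.
module Submission where

open import Defs
open import Level using (Level)
open import Algebra.Bundles using (CommutativeRing)
open import Algebra.Solver.Ring.AlmostCommutativeRing
  using (AlmostCommutativeRing; fromCommutativeRing; _-Raw-AlmostCommutative⟶_)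
import Algebra.Solver.Ring
open import Data.Integer as ℤ using (ℤ; +_; -[1+_]; _⊖_)
import Data.Integer.Properties as ℤ
open import Data.Integer.Tactic.RingSolver using (solve-∀)
open import Data.List using (List; []; _∷_)
open import Data.Maybe using (Maybe; nothing; just)
open import Data.Nat as ℕ using (ℕ; zero; suc)
open import Data.Product using (∃₂; _,_)
open import Function using (_∘_)
open import Relation.Nullary using (¬_; yes; no)
open import Relation.Binary.PropositionalEquality as ≡ using (_≡_)

⊖-+-⊖ : ∀ m n p q → (m ⊖ n) ℤ.+ (p ⊖ q) ≡ (m ℕ.+ p) ⊖ (n ℕ.+ q)
⊖-+-⊖ m n p q = begin
  (m ⊖ n) ℤ.+ (p ⊖ q)              ≡⟨ ≡.cong₂ ℤ._+_ (ℤ.m-n≡m⊖n m n) (ℤ.m-n≡m⊖n p q) ⟨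
  (+ m ℤ.- + n) ℤ.+ (+ p ℤ.- + q)  ≡⟨ interchange (+ m) (+ n) (+ p) (+ q) ⟩
  + (m ℕ.+ p) ℤ.- + (n ℕ.+ q)      ≡⟨ ℤ.m-n≡m⊖n (m ℕ.+ p) (n ℕ.+ q) ⟩
  (m ℕ.+ p) ⊖ (n ℕ.+ q)            ∎
  where
  open ≡.≡-Reasoning
  interchange : ∀ a b c d → (a ℤ.- b) ℤ.+ (c ℤ.- d) ≡ (a ℤ.+ c) ℤ.- (b ℤ.+ d)
  interchange = solve-∀

⊖-*-distribʳ : ∀ m n y → (m ⊖ n) ℤ.* y ≡ + m ℤ.* y ℤ.- + n ℤ.* y
⊖-*-distribʳ m n y = begin
  (m ⊖ n) ℤ.* y              ≡⟨ ≡.cong (ℤ._* y) (ℤ.m-n≡m⊖n m n) ⟨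
  (+ m ℤ.- + n) ℤ.* y        ≡⟨ distribʳ (+ m) (+ n) y ⟩
  + m ℤ.* y ℤ.- + n ℤ.* y    ∎
  where
  open ≡.≡-Reasoning
  distribʳ : ∀ a b y → (a ℤ.- b) ℤ.* y ≡ a ℤ.* y ℤ.- b ℤ.* y
  distribʳ = solve-∀

module IntegerRingSolver {f ℓ} (R : CommutativeRing f ℓ) where
  open CommutativeRing R
  open import Algebra.Properties.Ring ring
    using (-0#≈0#; -‿involutive; -‿+-comm; [y-z]x≈yx-zx)
  open import Algebra.Properties.CommutativeSemigroup +-commutativeSemigroup
    using (interchange)
  open import Algebra.Properties.Semiring.Mult semiring using (_×_; ×-homo-+)
  open import Relation.Binary.Reasoning.Setoid setoid

  ι : ℕ → Carrier
  ι n = n × 1#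

  ⟦_⟧ℤ : ℤ → Carrier
  ⟦ + n      ⟧ℤ = ι n
  ⟦ -[1+ n ] ⟧ℤ = - ι (suc n)

  ⊖-view : ∀ x → ∃₂ λ m n → x ≡ m ⊖ n
  ⊖-view (+ m)    = m , 0 , ≡.refl
  ⊖-view -[1+ n ] = 0 , suc n , ≡.refl

  x-0≈x : ∀ x → x - 0# ≈ x
  x-0≈x x = trans (+-congˡ -0#≈0#) (+-identityʳ x)

  [z+x]-[z+y]≈x-y : ∀ x y z → (z + x) - (z + y) ≈ x - y
  [z+x]-[z+y]≈x-y x y z = begin
    (z + x) + - (z + y)    ≈⟨ +-congˡ (-‿+-comm z y) ⟨
    (z + x) + (- z + - y)  ≈⟨ interchange z x (- z) (- y) ⟩
    (z - z) + (x - y)      ≈⟨ +-congʳ (-‿inverseʳ z) ⟩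
    0# + (x - y)           ≈⟨ +-identityˡ (x - y) ⟩
    x - y                  ∎

  ⟦⊖⟧ : ∀ m n → ⟦ m ⊖ n ⟧ℤ ≈ ι m - ι n
  ⟦⊖⟧ m       zero    = sym (x-0≈x (ι m))
  ⟦⊖⟧ zero    (suc n) = sym (+-identityˡ _)
  ⟦⊖⟧ (suc m) (suc n) = begin
    ⟦ suc m ⊖ suc n ⟧ℤ       ≡⟨ ≡.cong ⟦_⟧ℤ (ℤ.[1+m]⊖[1+n]≡m⊖n m n) ⟩
    ⟦ m ⊖ n ⟧ℤ               ≈⟨ ⟦⊖⟧ m n ⟩
    ι m - ι n                ≈⟨ [z+x]-[z+y]≈x-y (ι m) (ι n) 1# ⟨
    ι (suc m) - ι (suc n)    ∎

  +-homo : ∀ x y → ⟦ x ℤ.+ y ⟧ℤ ≈ ⟦ x ⟧ℤ + ⟦ y ⟧ℤ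
  +-homo x y with ⊖-view x | ⊖-view y
  ... | m , n , ≡.refl | p , q , ≡.refl = begin
    ⟦ (m ⊖ n) ℤ.+ (p ⊖ q) ⟧ℤ         ≡⟨ ≡.cong ⟦_⟧ℤ (⊖-+-⊖ m n p q) ⟩
    ⟦ (m ℕ.+ p) ⊖ (n ℕ.+ q) ⟧ℤ       ≈⟨ ⟦⊖⟧ (m ℕ.+ p) (n ℕ.+ q) ⟩
    ι (m ℕ.+ p) - ι (n ℕ.+ q)        ≈⟨ +-cong (×-homo-+ 1# m p) (-‿cong (×-homo-+ 1# n q)) ⟩
    (ι m + ι p) + - (ι n + ι q)      ≈⟨ +-congˡ (-‿+-comm (ι n) (ι q)) ⟨
    (ι m + ι p) + (- ι n + - ι q)    ≈⟨ interchange (ι m) (ι p) (- ι n) (- ι q) ⟩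
    (ι m - ι n) + (ι p - ι q)        ≈⟨ +-cong (⟦⊖⟧ m n) (⟦⊖⟧ p q) ⟨
    ⟦ m ⊖ n ⟧ℤ + ⟦ p ⊖ q ⟧ℤ          ∎

  -‿homo : ∀ x → ⟦ ℤ.- x ⟧ℤ ≈ - ⟦ x ⟧ℤ
  -‿homo (+ zero)  = sym -0#≈0#
  -‿homo (+ suc n) = refl
  -‿homo -[1+ n ]  = sym (-‿involutive _)

  ι*-homo : ∀ m y → ⟦ + m ℤ.* y ⟧ℤ ≈ ι m * ⟦ y ⟧ℤ
  ι*-homo zero    y = sym (zeroˡ ⟦ y ⟧ℤ)
  ι*-homo (suc m) y = begin
    ⟦ + suc m ℤ.* y ⟧ℤ               ≡⟨ ≡.cong ⟦_⟧ℤ (ℤ.suc-* (+ m) y) ⟩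
    ⟦ y ℤ.+ + m ℤ.* y ⟧ℤ             ≈⟨ +-homo y (+ m ℤ.* y) ⟩
    ⟦ y ⟧ℤ + ⟦ + m ℤ.* y ⟧ℤ          ≈⟨ +-cong (sym (*-identityˡ ⟦ y ⟧ℤ)) (ι*-homo m y) ⟩
    1# * ⟦ y ⟧ℤ + ι m * ⟦ y ⟧ℤ       ≈⟨ distribʳ ⟦ y ⟧ℤ 1# (ι m) ⟨
    ι (suc m) * ⟦ y ⟧ℤ               ∎

  *-homo : ∀ x y → ⟦ x ℤ.* y ⟧ℤ ≈ ⟦ x ⟧ℤ * ⟦ y ⟧ℤ
  *-homo x y with ⊖-view x
  ... | m , n , ≡.refl = begin
    ⟦ (m ⊖ n) ℤ.* y ⟧ℤ                     ≡⟨ ≡.cong ⟦_⟧ℤ (⊖-*-distribʳ m n y) ⟩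
    ⟦ + m ℤ.* y ℤ.- + n ℤ.* y ⟧ℤ           ≈⟨ +-homo (+ m ℤ.* y) (ℤ.- (+ n ℤ.* y)) ⟩
    ⟦ + m ℤ.* y ⟧ℤ + ⟦ ℤ.- (+ n ℤ.* y) ⟧ℤ  ≈⟨ +-congˡ (-‿homo (+ n ℤ.* y)) ⟩
    ⟦ + m ℤ.* y ⟧ℤ - ⟦ + n ℤ.* y ⟧ℤ        ≈⟨ +-cong (ι*-homo m y) (-‿cong (ι*-homo n y)) ⟩
    ι m * ⟦ y ⟧ℤ - ι n * ⟦ y ⟧ℤ            ≈⟨ [y-z]x≈yx-zx ⟦ y ⟧ℤ (ι m) (ι n) ⟨
    (ι m - ι n) * ⟦ y ⟧ℤ                   ≈⟨ *-congʳ (⟦⊖⟧ m n) ⟨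
    ⟦ m ⊖ n ⟧ℤ * ⟦ y ⟧ℤ                    ∎

  private
    ring′ : AlmostCommutativeRing f ℓ
    ring′ = fromCommutativeRing R

    homomorphism : ℤ.+-*-rawRing -Raw-AlmostCommutative⟶ ring′
    homomorphism = record
      { ⟦_⟧    = ⟦_⟧ℤ
      ; +-homo = +-homo
      ; *-homo = *-homo
      ; -‿homo = -‿homo
      ; 0-homo = refl
      ; 1-homo = +-identityʳ 1#
      }

    ⟦_⟧ℤ≟_ : ∀ x y → Maybe (⟦ x ⟧ℤ ≈ ⟦ y ⟧ℤ)
    ⟦ x ⟧ℤ≟ y with x ℤ.≟ y
    ... | yes ≡.refl = just refl
    ... | no _       = nothing

  open Algebra.Solver.Ring ℤ.+-*-rawRing ring′ homomorphism ⟦_⟧ℤ≟_ public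

  -- con (+ 1) denotes 1# + 0#; to match occurrences of 1# on the nose use :1 instead.
  :1 : ∀ {n} → Polynomial n
  :1 = con (+ 0) :^ 0

  horner : ∀ {n} → List ℤ → Polynomial n → Polynomial n
  horner []       x = con (+ 0)
  horner (k ∷ ks) x = con k :+ x :* horner ks x

module _ {f ℓ} (F : Field f ℓ) where
  open Field F
  open FieldDefs F
  open IntegerRingSolver commutativeRing
  open import Algebra.Properties.Ring ring
    using (+-cancelʳ; x∙y⁻¹≈ε⇒x≈y; x≈y⇒x∙y⁻¹≈ε)
  open import Algebra.Definitions _≈_ using (AlmostLeftCancellative)
  open import Relation.Binary.Reasoning.Setoid setoid

  x⁻¹*[x*y]≈y : ∀ {x} y → ¬ x ≈ 0# → x ⁻¹ * (x * y) ≈ y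
  x⁻¹*[x*y]≈y {x} y x≉0 = begin
    x ⁻¹ * (x * y)  ≈⟨ *-assoc (x ⁻¹) x y ⟨
    x ⁻¹ * x * y    ≈⟨ *-congʳ (trans (*-comm (x ⁻¹) x) (⁻¹-inverse x x≉0)) ⟩
    1# * y          ≈⟨ *-identityˡ y ⟩
    y               ∎

  *-almostCancelˡ : AlmostLeftCancellative 0# _*_
  *-almostCancelˡ x y z x≉0 xy≈xz =
    trans (sym (x⁻¹*[x*y]≈y y x≉0)) (trans (*-congˡ xy≈xz) (x⁻¹*[x*y]≈y z x≉0))

  x*y≈0⇒y≈0 : ∀ {x y} → ¬ x ≈ 0# → x * y ≈ 0# → y ≈ 0#
  x*y≈0⇒y≈0 {x} {y} x≉0 xy≈0 = *-almostCancelˡ x y 0# x≉0 (trans xy≈0 (sym (zeroʳ x)))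

  x*y≉0 : ∀ {x y} → ¬ x ≈ 0# → ¬ y ≈ 0# → ¬ x * y ≈ 0#
  x*y≉0 x≉0 y≉0 xy≈0 = y≉0 (x*y≈0⇒y≈0 x≉0 xy≈0)

  x≉y⇒x-y≉0 : ∀ {x y} → ¬ x ≈ y → ¬ x - y ≈ 0#
  x≉y⇒x-y≉0 {x} {y} x≉y x-y≈0 = x≉y (x∙y⁻¹≈ε⇒x≈y x y x-y≈0)

  k*x≈y⇒x≈1/k*y : ∀ {k x y} → ¬ k ≈ 0# → k * x ≈ y → x ≈ (1# / k) * y
  k*x≈y⇒x≈1/k*y {k} {x} {y} k≉0 kx≈y = begin
    x                 ≈⟨ x⁻¹*[x*y]≈y x k≉0 ⟨
    k ⁻¹ * (k * x)    ≈⟨ *-cong (sym (*-identityˡ (k ⁻¹))) kx≈y ⟩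
    1# * k ⁻¹ * y     ∎

  drop-vanishing : ∀ {L R q X} → X ≈ 0# → L ≈ R + q * X → L ≈ R
  drop-vanishing {L} {R} {q} {X} X≈0 L≈R+qX = begin
    L           ≈⟨ L≈R+qX ⟩
    R + q * X   ≈⟨ +-congˡ (trans (*-congˡ X≈0) (zeroʳ q)) ⟩
    R + 0#      ≈⟨ +-identityʳ R ⟩
    R           ∎

  Σ₃-linear : ∀ {k A B a₁ a₂ a₃ b₁ b₂ b₃ x₁ x₂ x₃ y₁ y₂ y₃} →
              k * a₁ + b₁ ≈ A * x₁ + B * y₁ →
              k * a₂ + b₂ ≈ A * x₂ + B * y₂ →
              k * a₃ + b₃ ≈ A * x₃ + B * y₃ →
              k * (a₁ + a₂ + a₃) + (b₁ + b₂ + b₃) ≈ A * (x₁ + x₂ + x₃) + B * (y₁ + y₂ + y₃)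
  Σ₃-linear {k} {A} {B} {a₁} {a₂} {a₃} {b₁} {b₂} {b₃} {x₁} {x₂} {x₃} {y₁} {y₂} {y₃} e₁ e₂ e₃ = begin
    k * (a₁ + a₂ + a₃) + (b₁ + b₂ + b₃)
      ≈⟨ solve 7 (λ k a₁ a₂ a₃ b₁ b₂ b₃ → k :* (a₁ :+ a₂ :+ a₃) :+ (b₁ :+ b₂ :+ b₃)
                 := (k :* a₁ :+ b₁) :+ (k :* a₂ :+ b₂) :+ (k :* a₃ :+ b₃))
           refl k a₁ a₂ a₃ b₁ b₂ b₃ ⟩
    (k * a₁ + b₁) + (k * a₂ + b₂) + (k * a₃ + b₃)
      ≈⟨ +-cong (+-cong e₁ e₂) e₃ ⟩
    (A * x₁ + B * y₁) + (A * x₂ + B * y₂) + (A * x₃ + B * y₃)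
      ≈⟨ solve 8 (λ A B x₁ x₂ x₃ y₁ y₂ y₃
                   → (A :* x₁ :+ B :* y₁) :+ (A :* x₂ :+ B :* y₂) :+ (A :* x₃ :+ B :* y₃)
                 := A :* (x₁ :+ x₂ :+ x₃) :+ B :* (y₁ :+ y₂ :+ y₃))
           refl A B x₁ x₂ x₃ y₁ y₂ y₃ ⟩
    A * (x₁ + x₂ + x₃) + B * (y₁ + y₂ + y₃)
      ∎

  egf-+ : ∀ u v → egf (u +ₛ v) ≈ₛ egf u +ₛ egf v
  egf-+ u v n = distribʳ (fact n ⁻¹) (u n) (v n)

  egf-· : ∀ k u → egf (k ·ₛ u) ≈ₛ k ·ₛ egf u
  egf-· k u n = *-assoc k (u n) (fact n ⁻¹)

  egf-cong : ∀ {u v} → u ≈ₛ v → egf u ≈ₛ egf v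
  egf-cong u≈v n = *-congʳ (u≈v n)

  egf-powers₃ : ∀ k₁ k₂ k₃ a₁ a₂ a₃ →
                egf (k₁ ·ₛ (a₁ ^_) +ₛ k₂ ·ₛ (a₂ ^_) +ₛ k₃ ·ₛ (a₃ ^_))
                ≈ₛ k₁ ·ₛ expS a₁ +ₛ k₂ ·ₛ expS a₂ +ₛ k₃ ·ₛ expS a₃
  egf-powers₃ k₁ k₂ k₃ a₁ a₂ a₃ n = begin
    egf (k₁ ·ₛ (a₁ ^_) +ₛ k₂ ·ₛ (a₂ ^_) +ₛ k₃ ·ₛ (a₃ ^_)) n
      ≈⟨ trans (egf-+ (k₁ ·ₛ (a₁ ^_) +ₛ k₂ ·ₛ (a₂ ^_)) (k₃ ·ₛ (a₃ ^_)) n)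
               (+-congʳ (egf-+ (k₁ ·ₛ (a₁ ^_)) (k₂ ·ₛ (a₂ ^_)) n)) ⟩
    egf (k₁ ·ₛ (a₁ ^_)) n + egf (k₂ ·ₛ (a₂ ^_)) n + egf (k₃ ·ₛ (a₃ ^_)) n
      ≈⟨ +-cong (+-cong (egf-· k₁ (a₁ ^_) n) (egf-· k₂ (a₂ ^_) n)) (egf-· k₃ (a₃ ^_) n) ⟩
    (k₁ ·ₛ expS a₁ +ₛ k₂ ·ₛ expS a₂ +ₛ k₃ ·ₛ expS a₃) n
      ∎

  Tribonacci : (ℕ → Carrier) → Set ℓ
  Tribonacci u = ∀ n → u (3 ℕ.+ n) ≈ u (2 ℕ.+ n) + u (1 ℕ.+ n) + u n

  T-tribonacci : ∀ s₀ s₁ s₂ → Tribonacci (T s₀ s₁ s₂)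
  T-tribonacci s₀ s₁ s₂ n = refl

  tribonacci-suc : ∀ {u} → Tribonacci u → Tribonacci (u ∘ suc)
  tribonacci-suc u-rec n = u-rec (suc n)

  tribonacci-+ : ∀ {u v} → Tribonacci u → Tribonacci v → Tribonacci (u +ₛ v)
  tribonacci-+ {u} {v} u-rec v-rec n = begin
    u (3 ℕ.+ n) + v (3 ℕ.+ n)
      ≈⟨ +-cong (u-rec n) (v-rec n) ⟩
    (u (2 ℕ.+ n) + u (1 ℕ.+ n) + u n) + (v (2 ℕ.+ n) + v (1 ℕ.+ n) + v n)
      ≈⟨ solve 6 (λ u₂ u₁ u₀ v₂ v₁ v₀ → (u₂ :+ u₁ :+ u₀) :+ (v₂ :+ v₁ :+ v₀)
                                      := (u₂ :+ v₂) :+ (u₁ :+ v₁) :+ (u₀ :+ v₀))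
           refl (u (2 ℕ.+ n)) (u (1 ℕ.+ n)) (u n) (v (2 ℕ.+ n)) (v (1 ℕ.+ n)) (v n) ⟩
    (u (2 ℕ.+ n) + v (2 ℕ.+ n)) + (u (1 ℕ.+ n) + v (1 ℕ.+ n)) + (u n + v n)
      ∎

  tribonacci-· : ∀ k {u} → Tribonacci u → Tribonacci (k ·ₛ u)
  tribonacci-· k {u} u-rec n = begin
    k * u (3 ℕ.+ n)                                 ≈⟨ *-congˡ (u-rec n) ⟩
    k * (u (2 ℕ.+ n) + u (1 ℕ.+ n) + u n)           ≈⟨ distribˡ k _ (u n) ⟩
    k * (u (2 ℕ.+ n) + u (1 ℕ.+ n)) + k * u n       ≈⟨ +-congʳ (distribˡ k _ _) ⟩
    k * u (2 ℕ.+ n) + k * u (1 ℕ.+ n) + k * u n     ∎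

  tribonacci-unique : ∀ {u v} → Tribonacci u → Tribonacci v →
                      u 0 ≈ v 0 → u 1 ≈ v 1 → u 2 ≈ v 2 → u ≈ₛ v
  tribonacci-unique {u} {v} u-rec v-rec e₀ e₁ e₂ = go
    where
    go : u ≈ₛ v
    go 0 = e₀
    go 1 = e₁
    go 2 = e₂
    go (suc (suc (suc n))) = begin
      u (3 ℕ.+ n)                         ≈⟨ u-rec n ⟩
      u (2 ℕ.+ n) + u (1 ℕ.+ n) + u n     ≈⟨ +-cong (+-cong (go (suc (suc n))) (go (suc n))) (go n) ⟩
      v (2 ℕ.+ n) + v (1 ℕ.+ n) + v n     ≈⟨ v-rec n ⟨
      v (3 ℕ.+ n)                         ∎

  T[3,1,3] T[5,6,15] : ℕ → Carrier
  T[3,1,3]  = T (fromℕ 3) (fromℕ 1) (fromℕ 3)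
  T[5,6,15] = T (fromℕ 5) (fromℕ 6) (fromℕ 15)

  T[5,6,15]-via-T[3,1,3] : ∀ n → fromℕ 25 * T[3,1,3] n + fromℕ 38 * T[3,1,3] (1 ℕ.+ n)
                              ≈ fromℕ 22 * T[5,6,15] n + T[3,1,3] (2 ℕ.+ n)
  T[5,6,15]-via-T[3,1,3] = tribonacci-unique
    (tribonacci-+ (tribonacci-· (fromℕ 25) t-rec) (tribonacci-· (fromℕ 38) (tribonacci-suc t-rec)))
    (tribonacci-+ (tribonacci-· (fromℕ 22) (T-tribonacci _ _ _)) (tribonacci-suc (tribonacci-suc t-rec)))
    (solve 0 (c 25 :* c 3 :+ c 38 :* c 1 := c 22 :* c 5 :+ c 3) refl)
    (solve 0 (c 25 :* c 1 :+ c 38 :* c 3 := c 22 :* c 6 :+ (c 3 :+ c 1 :+ c 3)) refl)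
    (solve 0 (c 25 :* c 3 :+ c 38 :* (c 3 :+ c 1 :+ c 3)
              := c 22 :* c 15 :+ ((c 3 :+ c 1 :+ c 3) :+ c 3 :+ c 1)) refl)
    where
    t-rec : Tribonacci T[3,1,3]
    t-rec = T-tribonacci _ _ _
    c : ℕ → Polynomial 0
    c n = con (+ n)

  cubicᵖ : ∀ {n} → (a b c x : Polynomial n) → Polynomial n
  cubicᵖ a b c x = x :^ 3 :+ a :* x :^ 2 :+ b :* x :+ c

  cubic′ᵖ : ∀ {n} → (a b x : Polynomial n) → Polynomial n
  cubic′ᵖ a b x = con (+ 3) :* x :^ 2 :+ con (+ 2) :* a :* x :+ b

  cubic[,]ᵖ : ∀ {n} → (a b x y : Polynomial n) → Polynomial n
  cubic[,]ᵖ a b x y = x :* x :+ x :* y :+ y :* y :+ a :* (x :+ y) :+ b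

  module MonicCubic (a b c : Carrier) where

    p : Carrier → Carrier
    p x = x ^ 3 + a * x ^ 2 + b * x + c

    p′ : Carrier → Carrier
    p′ x = fromℕ 3 * x ^ 2 + fromℕ 2 * a * x + b

    p[_,_] : Carrier → Carrier → Carrier
    p[ x , y ] = x * x + x * y + y * y + a * (x + y) + b

    p[,]-vanishes : ∀ {x y} → p x ≈ 0# → p y ≈ 0# → ¬ x ≈ y → p[ x , y ] ≈ 0#
    p[,]-vanishes {x} {y} px≈0 py≈0 x≉y = x*y≈0⇒y≈0 (x≉y⇒x-y≉0 x≉y) (begin
      (x - y) * p[ x , y ]  ≈⟨ solve 5 (λ x y a b c → (x :- y) :* cubic[,]ᵖ a b x y
                                                   := cubicᵖ a b c x :- cubicᵖ a b c y)
                                        refl x y a b c ⟩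
      p x - p y             ≈⟨ +-cong px≈0 (-‿cong py≈0) ⟩
      0# - 0#               ≈⟨ -‿inverseʳ 0# ⟩
      0#                    ∎)

    module _ {α β γ : Carrier} (pα : p α ≈ 0#) (pβ : p β ≈ 0#) (pγ : p γ ≈ 0#)
             (α≉β : ¬ α ≈ β) (α≉γ : ¬ α ≈ γ) (β≉γ : ¬ β ≈ γ) where

      private
        p[α,β]≈0 : p[ α , β ] ≈ 0#
        p[α,β]≈0 = p[,]-vanishes pα pβ α≉β

      α+β+γ+a≈0 : α + β + γ + a ≈ 0#
      α+β+γ+a≈0 = x*y≈0⇒y≈0 (x≉y⇒x-y≉0 β≉γ) (begin
        (β - γ) * (α + β + γ + a)  ≈⟨ solve 5 (λ α β γ a b → (β :- γ) :* (α :+ β :+ γ :+ a)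
                                                       := cubic[,]ᵖ a b α β :- cubic[,]ᵖ a b α γ)
                                             refl α β γ a b ⟩
        p[ α , β ] - p[ α , γ ]    ≈⟨ +-cong p[α,β]≈0 (-‿cong (p[,]-vanishes pα pγ α≉γ)) ⟩
        0# - 0#                    ≈⟨ -‿inverseʳ 0# ⟩
        0#                         ∎)

      [α-β][α-γ]≈p′α : (α - β) * (α - γ) ≈ p′ α
      [α-β][α-γ]≈p′α = drop-vanishing α+β+γ+a≈0 (drop-vanishing p[α,β]≈0
        (solve 5 (λ α β γ a b → (α :- β) :* (α :- γ)
                              := cubic′ᵖ a b α :+ (β :- α) :* (α :+ β :+ γ :+ a)
                                 :+ (:- :1) :* cubic[,]ᵖ a b α β)
                 refl α β γ a b))

      powerSum₁ : α ^ 1 + β ^ 1 + γ ^ 1 ≈ - a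
      powerSum₁ = drop-vanishing α+β+γ+a≈0
        (solve 4 (λ α β γ a → α :^ 1 :+ β :^ 1 :+ γ :^ 1 := :- a :+ :1 :* (α :+ β :+ γ :+ a))
                 refl α β γ a)

      powerSum₂ : α ^ 2 + β ^ 2 + γ ^ 2 ≈ a * a - fromℕ 2 * b
      powerSum₂ = drop-vanishing α+β+γ+a≈0 (drop-vanishing p[α,β]≈0
        (solve 5 (λ α β γ a b → α :^ 2 :+ β :^ 2 :+ γ :^ 2
                              := a :* a :- con (+ 2) :* b
                                 :+ (α :+ β :+ γ :+ a :- con (+ 2) :* (a :+ α :+ β)) :* (α :+ β :+ γ :+ a)
                                 :+ con (+ 2) :* cubic[,]ᵖ a b α β)
                 refl α β γ a b))

  open MonicCubic (- 1#) (- 1#) (- 1#)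

  pᵖ p′ᵖ : ∀ {n} → Polynomial n → Polynomial n
  pᵖ  = cubicᵖ (:- :1) (:- :1) (:- :1)
  p′ᵖ = cubic′ᵖ (:- :1) (:- :1)

  root-of-cubic : ∀ {x} → cubic x ≈ 0# → p x ≈ 0#
  root-of-cubic {x} = trans (sym (solve 1 (λ x → x :^ 3 :- x :^ 2 :- x :- :1 := pᵖ x) refl x))

  tribonacci-powers : ∀ {r} → p r ≈ 0# → Tribonacci (r ^_)
  tribonacci-powers {r} pr≈0 n = drop-vanishing pr≈0
    (solve 2 (λ r x → r :* (r :* (r :* x))
                    := (r :* (r :* x) :+ r :* x :+ x) :+ x :* pᵖ r)
             refl r (r ^ n))

  -- In ℤ[x]/(p), 22·x/p′(x) = 5x² − 3x − 4, whose fifth power is 242·(25 + 38x − x²); the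
  -- quotient q is that of (25 + 38x − x²)·p′(x)⁵ − 21296·x⁵ by p.
  21296[rd]⁵+r²≈25+38r : ∀ {r d} → p r ≈ 0# → p′ r * d ≈ 1# →
                         fromℕ 21296 * (r * d) ^ 5 + r ^ 2 ≈ fromℕ 25 + fromℕ 38 * r
  21296[rd]⁵+r²≈25+38r {r} {d} pr≈0 p′r*d≈1 =
    drop-vanishing (x≈y⇒x∙y⁻¹≈ε p′r*d≈1) (drop-vanishing pr≈0 (solve 2 (λ r d →
       let u  = p′ᵖ r :* d
           h  = con (+ 25) :+ con (+ 38) :* r :- r :^ 2
           q  = horner (+ 25 ∷ + 263 ∷ + 716 ∷ -[1+ 1013 ] ∷ -[1+ 5733 ] ∷ + 23880 ∷
                        -[1+ 1223 ] ∷ -[1+ 15821 ] ∷ + 9801 ∷ -[1+ 242 ] ∷ []) r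
       in con (+ 21296) :* (r :* d) :^ 5 :+ r :^ 2
          := con (+ 25) :+ con (+ 38) :* r
             :+ h :* (u :^ 4 :+ u :^ 3 :+ u :^ 2 :+ u :+ :1) :* (u :- :1)
             :+ :- q :* d :^ 5 :* pᵖ r)
       refl r d))

  relation-*rⁿ : ∀ {k x r A B} → k * x + r ^ 2 ≈ A + B * r →
                 ∀ n → k * (x * r ^ n) + r ^ (2 ℕ.+ n) ≈ A * r ^ n + B * r ^ (1 ℕ.+ n)
  relation-*rⁿ {k} {x} {r} {A} {B} rel n = begin
    k * (x * r ^ n) + r ^ (2 ℕ.+ n)
      ≈⟨ solve 4 (λ k x r y → k :* (x :* y) :+ r :* (r :* y) := (k :* x :+ r :^ 2) :* y)
                 refl k x r (r ^ n) ⟩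
    (k * x + r ^ 2) * r ^ n
      ≈⟨ *-congʳ rel ⟩
    (A + B * r) * r ^ n
      ≈⟨ solve 4 (λ A B r y → (A :+ B :* r) :* y := A :* y :+ B :* (r :* y))
                 refl A B r (r ^ n) ⟩
    A * r ^ n + B * r ^ (1 ℕ.+ n)
      ∎

  21296c⁵+r²≈25+38r : ∀ {r s t} → p r ≈ 0# → p s ≈ 0# → p t ≈ 0# →
                      ¬ r ≈ s → ¬ r ≈ t → ¬ s ≈ t →
                      fromℕ 21296 * (r / ((r - s) * (r - t))) ^ 5 + r ^ 2 ≈ fromℕ 25 + fromℕ 38 * r
  21296c⁵+r²≈25+38r {r} {s} {t} pr ps pt r≉s r≉t s≉t = 21296[rd]⁵+r²≈25+38r pr (begin
    p′ r * D ⁻¹  ≈⟨ *-congʳ ([α-β][α-γ]≈p′α pr ps pt r≉s r≉t s≉t) ⟨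
    D * D ⁻¹     ≈⟨ ⁻¹-inverse D (x*y≉0 (x≉y⇒x-y≉0 r≉s) (x≉y⇒x-y≉0 r≉t)) ⟩
    1#           ∎)
    where
    D : Carrier
    D = (r - s) * (r - t)

  module _ (charZero : CharZero) {α β γ : Carrier}
           (cubic-α : cubic α ≈ 0#) (cubic-β : cubic β ≈ 0#) (cubic-γ : cubic γ ≈ 0#)
           (α≉β : ¬ α ≈ β) (α≉γ : ¬ α ≈ γ) (β≉γ : ¬ β ≈ γ) where

    private
      pα : p α ≈ 0#
      pα = root-of-cubic cubic-α
      pβ : p β ≈ 0#
      pβ = root-of-cubic cubic-β
      pγ : p γ ≈ 0#
      pγ = root-of-cubic cubic-γ

      c₁ c₂ c₃ : Carrier
      c₁ = α / ((α - β) * (α - γ))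
      c₂ = β / ((β - α) * (β - γ))
      c₃ = γ / ((γ - α) * (γ - β))

      S s : ℕ → Carrier
      S = c₁ ^ 5 ·ₛ (α ^_) +ₛ c₂ ^ 5 ·ₛ (β ^_) +ₛ c₃ ^ 5 ·ₛ (γ ^_)
      s = (α ^_) +ₛ (β ^_) +ₛ (γ ^_)

    s≈T[3,1,3] : s ≈ₛ T[3,1,3]
    s≈T[3,1,3] = tribonacci-unique
      (tribonacci-+ (tribonacci-+ (tribonacci-powers pα) (tribonacci-powers pβ)) (tribonacci-powers pγ))
      (T-tribonacci _ _ _)
      (solve 0 (:1 :+ :1 :+ :1 := con (+ 3)) refl)
      (trans (powerSum₁ pα pβ pγ α≉β α≉γ β≉γ) (solve 0 (:- (:- :1) := con (+ 1)) refl))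
      (trans (powerSum₂ pα pβ pγ α≉β α≉γ β≉γ)
             (solve 0 ((:- :1) :* (:- :1) :- con (+ 2) :* (:- :1) := con (+ 3)) refl))

    21296S+s≈25s+38s : ∀ n → fromℕ 21296 * S n + s (2 ℕ.+ n)
                           ≈ fromℕ 25 * s n + fromℕ 38 * s (1 ℕ.+ n)
    21296S+s≈25s+38s n = Σ₃-linear
      (relation-*rⁿ (21296c⁵+r²≈25+38r pα pβ pγ α≉β α≉γ β≉γ) n)
      (relation-*rⁿ (21296c⁵+r²≈25+38r pβ pα pγ (α≉β ∘ sym) β≉γ α≉γ) n)
      (relation-*rⁿ (21296c⁵+r²≈25+38r pγ pα pβ (α≉γ ∘ sym) (β≉γ ∘ sym) α≉β) n)

    S≈T[5,6,15]/968 : S ≈ₛ (1# / fromℕ 968) ·ₛ T[5,6,15]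
    S≈T[5,6,15]/968 n = k*x≈y⇒x≈1/k*y (charZero 967)
      (*-almostCancelˡ (fromℕ 22) _ _ (charZero 21) (+-cancelʳ (T[3,1,3] (2 ℕ.+ n)) _ _ (begin
        fromℕ 22 * (fromℕ 968 * S n) + T[3,1,3] (2 ℕ.+ n)
          ≈⟨ +-cong (solve 1 (λ x → con (+ 22) :* (con (+ 968) :* x) := con (+ 21296) :* x) refl (S n))
                    (sym (s≈T[3,1,3] (2 ℕ.+ n))) ⟩
        fromℕ 21296 * S n + s (2 ℕ.+ n)
          ≈⟨ 21296S+s≈25s+38s n ⟩
        fromℕ 25 * s n + fromℕ 38 * s (1 ℕ.+ n)
          ≈⟨ +-cong (*-congˡ (s≈T[3,1,3] n)) (*-congˡ (s≈T[3,1,3] (1 ℕ.+ n))) ⟩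
        fromℕ 25 * T[3,1,3] n + fromℕ 38 * T[3,1,3] (1 ℕ.+ n)
          ≈⟨ T[5,6,15]-via-T[3,1,3] n ⟩
        fromℕ 22 * T[5,6,15] n + T[3,1,3] (2 ℕ.+ n)
          ∎)))

lemma9 : {c ℓ : Level} (F : Field c ℓ) → let open Field F in let open FieldDefs F in
    CharZero → (α β γ : Carrier) →
    cubic α ≈ 0# → cubic β ≈ 0# → cubic γ ≈ 0# →
    ¬ (α ≈ β) → ¬ (α ≈ γ) → ¬ (β ≈ γ) →
    let c₁ = α / ((α - β) * (α - γ))
        c₂ = β / ((β - α) * (β - γ))
        c₃ = γ / ((γ - α) * (γ - β))
    in ((c₁ ^ 5) ·ₛ expS α) +ₛ ((c₂ ^ 5) ·ₛ expS β) +ₛ ((c₃ ^ 5) ·ₛ expS γ)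
       ≈ₛ ((1# / fromℕ 968) ·ₛ egf (T (fromℕ 5) (fromℕ 6) (fromℕ 15)))
lemma9 F charZero α β γ cubic-α cubic-β cubic-γ α≉β α≉γ β≉γ n =
  trans (sym (egf-powers₃ F _ _ _ α β γ n))
        (trans (egf-cong F (S≈T[5,6,15]/968 F charZero cubic-α cubic-β cubic-γ α≉β α≉γ β≉γ) n)
               (egf-· F (1# / fromℕ 968) (T[5,6,15] F) n))
  where
  open Field F
  open FieldDefs F
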